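{- For all integers $n\ge 0$ and $s\ge 1$, $$a_{n,s}=\sum_{k=0}^{s-1}\binom{n+k}{k}\,y_{n,s-k-1},$$ and conversely, for all integers $n\ge 0$ and $k\ge 0$, $$y_{n,k}=\sum_{j=1}^{k+1}(-1)^{k-j+1}\binom{n+1}{k-j+1}\,a_{n,j}.$$
   Context: A semistandard Young tableau on $s$ symbols of shape $\lambda$ (a Ferrers diagram) is a filling of the cells of $\lambda$ with integers in $\{1,\dots,s\}$ (not necessarily all used), strictly increasing along rows and weakly increasing down columns; $a_{n,s}$ denotes the number of semistandard Young tableaux with $n$ cells on $s$ symbols. A reverse Yamanouchi word is a word $w=w_1\cdots w_n$ with positive integer entries such that for every prefix $w_1\cdots w_m$ and every $i\ge1$, the number of occurrences of $i+1$ in the prefix does not exceed the number of occurrences of $i$. The descent set of a word $w$ is $\{1\le i<n: w_i\ge w_{i+1}\}$, and $d(w)$ is its cardinality. $y_{n,k}$ denotes the number of reverse Yamanouchi words of length $n$ with exactly $k$ descents (so $y_{n,k}=0$ when $k\ge n$ and $n\ge 1$). -}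

module Defs where

open import Data.Nat using (ℕ; zero; suc; _+_; _≤_; _<_; _≟_; _≤ᵇ_)
open import Data.Bool using (if_then_else_)
open import Data.List using (List; []; _∷_; length; map; take; filter)
open import Data.Nat.ListAction using (sum)
open import Data.List.Relation.Unary.All using (All)
open import Data.List.Relation.Unary.Linked using (Linked)
open import Data.List.Relation.Unary.Unique.Propositional using (Unique)
open import Data.List.Membership.Propositional using (_∈_)
open import Data.Product using (_×_)
open import Function.Bundles using (_⇔_)
open import Relation.Binary.PropositionalEquality using (_≡_)
import Data.Integer as ℤ

record HasCount {A : Set} (P : A → Set) (c : ℕ) : Set where
  field
    elems    : List A
    unique   : Unique elems
    complete : ∀ x → (x ∈ elems) ⇔ P x
    size     : length elems ≡ c

-- Semistandard Young tableaux (with the paper's convention: rows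
-- strictly increasing, columns weakly increasing).
-- A filling is represented as the list of its rows, top to bottom,
-- each row listed left to right (English notation).

Tableau : Set
Tableau = List (List ℕ)

-- `upper ⊒ lower`: the row `lower` sits directly below the row `upper`
-- in a Ferrers diagram (so it is not longer than `upper`), and every
-- entry of `lower` is ≥ the entry of `upper` directly above it.
data _⊒_ : List ℕ → List ℕ → Set where
  below-[] : ∀ {xs} → xs ⊒ []
  below-∷  : ∀ {x y xs ys} → x ≤ y → xs ⊒ ys → (x ∷ xs) ⊒ (y ∷ ys)

cells : Tableau → ℕ
cells T = sum (map length T)

NonEmpty : List ℕ → Set
NonEmpty xs = 1 ≤ length xs

InRange : ℕ → ℕ → Set
InRange s x = 1 ≤ x × x ≤ s

IsSSYT : ℕ → ℕ → Tableau → Set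
IsSSYT n s T =
  cells T ≡ n
  × All NonEmpty T
  × All (All (InRange s)) T
  × All (Linked _<_) T
  × Linked _⊒_ T

Word : Set
Word = List ℕ

occ : ℕ → Word → ℕ
occ i w = length (filter (_≟ i) w)

IsRevYamanouchi : Word → Set
IsRevYamanouchi w =
  All (1 ≤_) w
  × (∀ m i → 1 ≤ i → occ (suc i) (take m w) ≤ occ i (take m w))

des : Word → ℕ
des []            = 0
des (x ∷ [])      = 0
des (x ∷ y ∷ ws)  = (if y ≤ᵇ x then 1 else 0) + des (y ∷ ws)

IsRY : ℕ → ℕ → Word → Set
IsRY n k w = length w ≡ n × IsRevYamanouchi w × des w ≡ k

sumℤ : List ℤ.ℤ → ℤ.ℤ
sumℤ [] = ℤ.+ 0
sumℤ (x ∷ xs) = x ℤ.+ sumℤ xs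

module Submission where

-- An SSYT with n cells on s symbols is recorded by its cells (entry v , row x), listed from the
-- largest to the smallest in the lexicographic order.  Read from the smallest cell, the rows form a
-- reverse Yamanouchi word w, since a new cell only extends a row shorter than the one above it, and
-- the entries form a weakly increasing sequence in {1,…,s} which increases strictly at every descent
-- of w, since equal entries lie in strictly lower rows.  Conversely such a pair builds a tableau cell
-- by cell, and the tableau gives the pair back by repeatedly removing its largest cell.  When w has
-- d descents there are (n + k choose k) such sequences, k = s - 1 - d, which is the first identity.
-- It says that (a_{n,1+i})ᵢ is the convolution of (y_{n,k})ₖ with the coefficients of
-- (1 - x) ^ -(n + 1); convolving with the coefficients (-1) ^ j (n + 1 choose j) of (1 - x) ^ (n + 1)
-- inverts it.

module PowerSeries where

  open import Data.Nat as ℕ using (ℕ; zero; suc; _∸_; _<_; s≤s; z≤n)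
  open import Data.Nat.Properties using (n∸n≡0; +-∸-assoc; +-suc)
  open import Data.Nat.Combinatorics using (_C_; nCn≡1; nCk+nC[k+1]≡[n+1]C[k+1])
  open import Data.Integer using (ℤ; +_; -_; _+_; _-_; _*_; _^_)
  open import Data.Integer.Properties using (pos-+; +-identityˡ)
  open import Data.Integer.Tactic.RingSolver using (solve-∀)
  open import Function using (_∘_)
  open import Data.List using (List; []; _∷_; map; applyUpTo; upTo)
  open import Data.Nat.ListAction using (sum)
  open import Defs using (sumℤ)
  open import Relation.Binary.PropositionalEquality

  ∑ : ℕ → (ℕ → ℤ) → ℤ
  ∑ zero    f = + 0
  ∑ (suc k) f = f 0 + ∑ k (f ∘ suc)

  ∑-cong : ∀ k {f g : ℕ → ℤ} → (∀ {i} → i < k → f i ≡ g i) → ∑ k f ≡ ∑ k g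
  ∑-cong zero    f≡g = refl
  ∑-cong (suc k) f≡g = cong₂ _+_ (f≡g (s≤s z≤n)) (∑-cong k (f≡g ∘ s≤s))

  ∑-suc : ∀ k (f : ℕ → ℤ) → ∑ (suc k) f ≡ ∑ k f + f k
  ∑-suc zero    f = lemma (f 0)
    where lemma : ∀ a → a + + 0 ≡ + 0 + a
          lemma = solve-∀
  ∑-suc (suc k) f = trans (cong (λ z → f 0 + z) (∑-suc k (f ∘ suc))) (lemma (f 0) _ _)
    where lemma : ∀ a b c → a + (b + c) ≡ a + b + c
          lemma = solve-∀

  ∑-zero : ∀ k → ∑ k (λ _ → + 0) ≡ + 0
  ∑-zero zero    = refl
  ∑-zero (suc k) = trans (+-identityˡ _) (∑-zero k)

  ∑-sub : ∀ k (f g : ℕ → ℤ) → ∑ k (λ i → f i - g i) ≡ ∑ k f - ∑ k g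
  ∑-sub zero    f g = refl
  ∑-sub (suc k) f g = trans (cong (λ z → f 0 - g 0 + z) (∑-sub k (f ∘ suc) (g ∘ suc))) (lemma (f 0) (g 0) _ _)
    where lemma : ∀ a b c d → (a - b) + (c - d) ≡ (a + c) - (b + d)
          lemma = solve-∀

  sumℤ-applyUpTo : ∀ (f : ℕ → ℤ) g k → sumℤ (map f (applyUpTo g k)) ≡ ∑ k (f ∘ g)
  sumℤ-applyUpTo f g zero    = refl
  sumℤ-applyUpTo f g (suc k) = cong (λ z → f (g 0) + z) (sumℤ-applyUpTo f (g ∘ suc) k)

  sumℤ-upTo : ∀ (f : ℕ → ℤ) k → sumℤ (map f (upTo k)) ≡ ∑ k f
  sumℤ-upTo f = sumℤ-applyUpTo f (λ i → i)

  pos-sum : ∀ {A : Set} (f : A → ℕ) xs → + sum (map f xs) ≡ sumℤ (map (λ x → + f x) xs)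
  pos-sum f []       = refl
  pos-sum f (x ∷ xs) = trans (pos-+ (f x) _) (cong (λ z → + f x + z) (pos-sum f xs))

  Series : Set
  Series = ℕ → ℤ

  _⋆_ : Series → Series → Series
  (u ⋆ v) k = ∑ (suc k) (λ i → u (k ∸ i) * v i)

  δ : Series
  δ zero    = + 1
  δ (suc _) = + 0

  -- Multiplication by 1 - x.
  Δ : Series → Series
  Δ u zero    = u 0
  Δ u (suc j) = u (suc j) - u j

  ⋆-congˡ : ∀ {u u′} v → u ≗ u′ → u ⋆ v ≗ u′ ⋆ v
  ⋆-congˡ v u≗u′ k = ∑-cong (suc k) (λ {i} _ → cong (_* v i) (u≗u′ (k ∸ i)))

  ⋆-congʳ : ∀ u {v v′} → v ≗ v′ → u ⋆ v ≗ u ⋆ v′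
  ⋆-congʳ u v≗v′ k = ∑-cong (suc k) (λ {i} _ → cong (u (k ∸ i) *_) (v≗v′ i))

  ⋆-suc : ∀ u v k → (u ⋆ v) (suc k) ≡ ((u ∘ suc) ⋆ v) k + u 0 * v (suc k)
  ⋆-suc u v k = trans (∑-suc (suc k) (λ i → u (suc k ∸ i) * v i))
    (cong₂ _+_ (∑-cong (suc k) shift) (cong (λ j → u j * v (suc k)) (n∸n≡0 (suc k))))
    where shift : ∀ {i} → i < suc k → u (suc k ∸ i) * v i ≡ u (suc (k ∸ i)) * v i
          shift {i} (s≤s i≤k) = cong (λ j → u j * v i) (+-∸-assoc 1 i≤k)

  ⋆-subʳ : ∀ u (f g : Series) → u ⋆ (λ i → f i - g i) ≗ λ k → (u ⋆ f) k - (u ⋆ g) k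
  ⋆-subʳ u f g k = trans (∑-cong (suc k) (λ {i} _ → lemma (u (k ∸ i)) (f i) (g i)))
    (∑-sub (suc k) (λ i → u (k ∸ i) * f i) (λ i → u (k ∸ i) * g i))
    where lemma : ∀ a x y → a * (x - y) ≡ a * x - a * y
          lemma = solve-∀

  ⋆-subˡ : ∀ (f g : Series) v → (λ i → f i - g i) ⋆ v ≗ λ k → (f ⋆ v) k - (g ⋆ v) k
  ⋆-subˡ f g v k = trans (∑-cong (suc k) (λ {i} _ → lemma (f (k ∸ i)) (g (k ∸ i)) (v i)))
    (∑-sub (suc k) (λ i → f (k ∸ i) * v i) (λ i → g (k ∸ i) * v i))
    where lemma : ∀ a b x → (a - b) * x ≡ a * x - b * x
          lemma = solve-∀

  ⋆-identityˡ : ∀ v → δ ⋆ v ≗ v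
  ⋆-identityˡ v zero    = lemma (v 0)
    where lemma : ∀ a → + 1 * a + + 0 ≡ a
          lemma = solve-∀
  ⋆-identityˡ v (suc k) = trans (cong (λ z → + 0 * v 0 + z) (⋆-identityˡ (v ∘ suc) k)) (lemma (v 0) (v (suc k)))
    where lemma : ∀ a b → + 0 * a + b ≡ b
          lemma = solve-∀

  ⋆-identityʳ : ∀ u → u ⋆ δ ≗ u
  ⋆-identityʳ u k =
    trans (cong (λ z → u k * + 1 + z) (trans (∑-cong k (λ {i} _ → lemma₀ (u (k ∸ suc i)))) (∑-zero k))) (lemma₁ (u k))
    where lemma₀ : ∀ a → a * + 0 ≡ + 0
          lemma₀ = solve-∀
          lemma₁ : ∀ a → a * + 1 + + 0 ≡ a
          lemma₁ = solve-∀

  Δ-⋆ʳ : ∀ u v → Δ (u ⋆ v) ≗ u ⋆ Δ v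
  Δ-⋆ʳ u v zero    = refl
  Δ-⋆ʳ u v (suc k) = trans (lemma (u (suc k) * v 0) ((u ⋆ (v ∘ suc)) k) ((u ⋆ v) k))
                           (cong (λ z → u (suc k) * v 0 + z) (sym (⋆-subʳ u (v ∘ suc) v k)))
    where lemma : ∀ a b c → a + b - c ≡ a + (b - c)
          lemma = solve-∀

  Δ-⋆ˡ : ∀ u v → Δ (u ⋆ v) ≗ Δ u ⋆ v
  Δ-⋆ˡ u v zero    = refl
  Δ-⋆ˡ u v (suc k) = begin
    (u ⋆ v) (suc k) - (u ⋆ v) k                          ≡⟨ cong (_- (u ⋆ v) k) (⋆-suc u v k) ⟩
    ((u ∘ suc) ⋆ v) k + u 0 * v (suc k) - (u ⋆ v) k      ≡⟨ lemma (((u ∘ suc) ⋆ v) k) (u 0 * v (suc k)) ((u ⋆ v) k) ⟩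
    ((u ∘ suc) ⋆ v) k - (u ⋆ v) k + u 0 * v (suc k)      ≡⟨ cong (_+ u 0 * v (suc k)) (⋆-subˡ (u ∘ suc) u v k) ⟨
    ((Δ u ∘ suc) ⋆ v) k + Δ u 0 * v (suc k)              ≡⟨ ⋆-suc (Δ u) v k ⟨
    (Δ u ⋆ v) (suc k)                                    ∎
    where open ≡-Reasoning
          lemma : ∀ a b c → a + b - c ≡ (a - c) + b
          lemma = solve-∀

  [1-x]^ : ℕ → Series
  [1-x]^ p j = (- + 1) ^ j * + (p C j)

  [1-x]^- : ℕ → Series
  [1-x]^- zero    = δ
  [1-x]^- (suc p) j = + ((p ℕ.+ j) C j)

  [1-x]^0 : [1-x]^ 0 ≗ δ
  [1-x]^0 zero    = refl
  [1-x]^0 (suc j) = lemma ((- + 1) ^ suc j)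
    where lemma : ∀ a → a * + 0 ≡ + 0
          lemma = solve-∀

  Δ-[1-x]^ : ∀ p → Δ ([1-x]^ p) ≗ [1-x]^ (suc p)
  Δ-[1-x]^ p zero    = refl
  Δ-[1-x]^ p (suc j) = trans (lemma ((- + 1) ^ j) (+ (p C j)) (+ (p C suc j)))
    (cong ((- + 1) ^ suc j *_) (trans (sym (pos-+ (p C j) (p C suc j))) (cong +_ (nCk+nC[k+1]≡[n+1]C[k+1] p j))))
    where lemma : ∀ t x y → - + 1 * t * y - t * x ≡ - + 1 * t * (x + y)
          lemma = solve-∀

  Δ-[1-x]^- : ∀ p → Δ ([1-x]^- (suc p)) ≗ [1-x]^- p
  Δ-[1-x]^- zero    zero    = refl
  Δ-[1-x]^- (suc p) zero    = refl
  Δ-[1-x]^- zero    (suc j) = cong₂ (λ a b → + a - + b) (nCn≡1 (suc j)) (nCn≡1 j)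
  Δ-[1-x]^- (suc p) (suc j) = begin
    + ((suc p ℕ.+ suc j) C suc j) - + (m C j)   ≡⟨ cong (λ i → + (i C suc j) - + (m C j)) (+-suc (suc p) j) ⟩
    + (suc m C suc j) - + (m C j)               ≡⟨ cong (λ i → + i - + (m C j)) (nCk+nC[k+1]≡[n+1]C[k+1] m j) ⟨
    + (m C j ℕ.+ m C suc j) - + (m C j)         ≡⟨ cong (_- + (m C j)) (pos-+ (m C j) _) ⟩
    + (m C j) + + (m C suc j) - + (m C j)       ≡⟨ lemma (+ (m C j)) (+ (m C suc j)) ⟩
    + (m C suc j)                               ≡⟨ cong (λ i → + (i C suc j)) (+-suc p j) ⟨
    + ((p ℕ.+ suc j) C suc j)                   ∎
    where open ≡-Reasoning
          m = suc p ℕ.+ j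
          lemma : ∀ a b → a + b - a ≡ b
          lemma = solve-∀

  Δ-cong : ∀ {u v} → u ≗ v → Δ u ≗ Δ v
  Δ-cong u≗v zero    = u≗v 0
  Δ-cong u≗v (suc j) = cong₂ _-_ (u≗v (suc j)) (u≗v j)

  -- Applying Δ to both sides lowers the exponent of (1 - x) ^ -p and raises that of (1 - x) ^ p,
  -- since Δ moves freely across ⋆.
  binomial-inversion : ∀ p (y b : Series) → b ≗ y ⋆ [1-x]^- p → y ≗ [1-x]^ p ⋆ b
  binomial-inversion zero    y b b≗y⋆δ k = sym (begin
    ([1-x]^ 0 ⋆ b) k   ≡⟨ ⋆-congˡ b [1-x]^0 k ⟩
    (δ ⋆ b) k          ≡⟨ ⋆-identityˡ b k ⟩
    b k                ≡⟨ b≗y⋆δ k ⟩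
    (y ⋆ δ) k          ≡⟨ ⋆-identityʳ y k ⟩
    y k                ∎)
    where open ≡-Reasoning
  binomial-inversion (suc p) y b b≗y⋆c k = begin
    y k                          ≡⟨ binomial-inversion p y (Δ b) Δb≗y⋆c k ⟩
    ([1-x]^ p ⋆ Δ b) k           ≡⟨ Δ-⋆ʳ ([1-x]^ p) b k ⟨
    Δ ([1-x]^ p ⋆ b) k           ≡⟨ Δ-⋆ˡ ([1-x]^ p) b k ⟩
    (Δ ([1-x]^ p) ⋆ b) k         ≡⟨ ⋆-congˡ b (Δ-[1-x]^ p) k ⟩
    ([1-x]^ (suc p) ⋆ b) k       ∎
    where
      open ≡-Reasoning
      Δb≗y⋆c : Δ b ≗ y ⋆ [1-x]^- p
      Δb≗y⋆c i = trans (Δ-cong b≗y⋆c i) (trans (Δ-⋆ʳ y ([1-x]^- (suc p)) i) (⋆-congʳ y (Δ-[1-x]^- p) i))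

open import Defs
open import Data.Bool using (true; false; if_then_else_)
import Data.Bool as Bool
open import Data.Empty using (⊥; ⊥-elim)
open import Data.List using (List; []; _∷_; _++_; [_]; _∷ʳ_; length; map; head; take; filter; reverse; concatMap; upTo; initLast; _∷ʳ′_)
open import Data.List.Membership.Propositional using (_∈_; lose; find)
open import Data.List.Membership.Propositional.Properties using (∈-++⁺ˡ; ∈-++⁺ʳ; ∈-++⁻; ∈-map⁺; ∈-map⁻; ∈-concatMap⁺; ∈-concatMap⁻; ∈-upTo⁺; ∈-upTo⁻)
open import Data.List.Membership.Propositional.Properties.WithK using (unique∧set⇒bag)
open import Data.List.Properties using (length-++; length-map; length-reverse; filter-++; filter-accept; filter-reject; unfold-reverse; reverse-involutive; reverse-injective; take-all; ∷-injective; ∷-injectiveʳ; ∷ʳ-injective)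
open import Data.List.Relation.Binary.BagAndSetEquality using (∼bag⇒↭)
open import Data.List.Relation.Binary.Permutation.Propositional.Properties using (↭-length)
open import Data.List.Relation.Unary.All using (All; []; _∷_)
import Data.List.Relation.Unary.All as All
import Data.List.Relation.Unary.All.Properties as All
open import Data.List.Relation.Unary.AllPairs using (_∷_)
open import Data.List.Relation.Unary.Any using (here; there)
import Data.List.Relation.Unary.Any.Properties as Any
open import Data.List.Relation.Unary.Linked using (Linked; []; [-]; _∷_; _∷′_)
import Data.List.Relation.Unary.Linked as Linked
open import Data.List.Relation.Unary.Unique.Propositional using (Unique)
import Data.List.Relation.Unary.Unique.Propositional.Properties as Unique
open import Data.Maybe using (just)
open import Data.Maybe.Relation.Binary.Connected using (Connected; just; just-nothing)
open import Data.Nat using (ℕ; zero; suc; _+_; _*_; _∸_; _≤_; _<_; _≟_; _<?_; _≤?_; _≤ᵇ_; z≤n; s≤s; s≤s⁻¹; pred)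
open import Data.Nat.Combinatorics using (_C_; nCn≡1; nCk+nC[k+1]≡[n+1]C[k+1])
open import Data.Nat.ListAction using (sum)
open import Data.Nat.Properties
open import Data.Product using (∃; _×_; _,_; proj₁; proj₂)
open import Data.Product.Relation.Binary.Lex.Strict using (×-Lex)
open import Data.Sum using (_⊎_; inj₁; inj₂)
open import Data.Unit using (⊤; tt)
open import Function using (_∘_; flip; _⇔_; mk⇔; Equivalence)
open import Relation.Nullary using (yes; no)
open import Relation.Binary.PropositionalEquality hiding ([_])
open PowerSeries using (Series; _⋆_; [1-x]^; [1-x]^-; binomial-inversion; ∑; ∑-cong; sumℤ-upTo; pos-sum)

private variable
  A B : Set

∈-concatMap⁺′ : ∀ (f : A → List B) {xs x b} → x ∈ xs → b ∈ f x → b ∈ concatMap f xs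
∈-concatMap⁺′ f x∈xs b∈fx = ∈-concatMap⁺ f (lose x∈xs b∈fx)

∈-concatMap⁻′ : ∀ (f : A → List B) {xs b} → b ∈ concatMap f xs → ∃ λ x → x ∈ xs × b ∈ f x
∈-concatMap⁻′ f = find ∘ ∈-concatMap⁻ f

length-concatMap : ∀ (f : A → List B) xs → length (concatMap f xs) ≡ sum (map (length ∘ f) xs)
length-concatMap f []       = refl
length-concatMap f (x ∷ xs) = trans (length-++ (f x)) (cong (length (f x) +_) (length-concatMap f xs))

sum-map-cong-∈ : ∀ (f g : A → ℕ) xs → (∀ {x} → x ∈ xs → f x ≡ g x) → sum (map f xs) ≡ sum (map g xs)
sum-map-cong-∈ f g []       _   = refl
sum-map-cong-∈ f g (x ∷ xs) f≡g = cong₂ _+_ (f≡g (here refl)) (sum-map-cong-∈ f g xs (f≡g ∘ there))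

sum-map-const : ∀ (f : A → ℕ) xs c → (∀ {x} → x ∈ xs → f x ≡ c) → sum (map f xs) ≡ c * length xs
sum-map-const f []       c _    = sym (*-zeroʳ c)
sum-map-const f (x ∷ xs) c f≡c =
  trans (cong₂ _+_ (f≡c (here refl)) (sum-map-const f xs c (f≡c ∘ there))) (sym (*-suc c (length xs)))

concatMap-unique : ∀ (f : A → List B) {xs} → Unique xs → (∀ {x} → x ∈ xs → Unique (f x)) →
  (∀ {x x′ b} → x ∈ xs → x′ ∈ xs → b ∈ f x → b ∈ f x′ → x ≡ x′) → Unique (concatMap f xs)
concatMap-unique f {[]}     _          _       _        = Unique.[]
concatMap-unique f {x ∷ xs} (x∉ ∷ uxs) unique-f disjoint =
  Unique.++⁺ (unique-f (here refl))
    (concatMap-unique f uxs (unique-f ∘ there) (λ p q → disjoint (there p) (there q)))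
    (λ (b∈fx , b∈rest) → let x′ , x′∈xs , b∈fx′ = ∈-concatMap⁻′ f b∈rest in
       All.lookup x∉ x′∈xs (disjoint (here refl) (there x′∈xs) b∈fx b∈fx′))

map-unique : ∀ (f : A → B) {xs} → Unique xs → (∀ {x x′} → x ∈ xs → x′ ∈ xs → f x ≡ f x′ → x ≡ x′) →
  Unique (map f xs)
map-unique f {[]}     _          _   = Unique.[]
map-unique f {x ∷ xs} (x∉ ∷ uxs) inj =
  All.map⁺ (All.tabulate (λ x′∈xs fx≡fx′ → All.lookup x∉ x′∈xs (inj (here refl) (there x′∈xs) fx≡fx′)))
  ∷ map-unique f uxs (λ p q → inj (there p) (there q))

HasCount-length : ∀ {P : A → Set} {c xs} → HasCount P c → Unique xs → (∀ {x} → x ∈ xs ⇔ P x) → length xs ≡ c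
HasCount-length {xs = xs} count uxs xs⇔P = trans (↭-length (∼bag⇒↭ (unique∧set⇒bag uxs unique same))) size
  where
    open HasCount count
    same : ∀ {x} → x ∈ xs ⇔ x ∈ elems
    same {x} = mk⇔ (Equivalence.from (complete x) ∘ Equivalence.to xs⇔P)
                   (Equivalence.from xs⇔P ∘ Equivalence.to (complete x))

-- Reverse Yamanouchi words, read backwards

occ-∷-≡ : ∀ i w → occ i (i ∷ w) ≡ suc (occ i w)
occ-∷-≡ i w = cong length (filter-accept (_≟ i) {i} {w} refl)

occ-∷-≢ : ∀ {i x} w → x ≢ i → occ i (x ∷ w) ≡ occ i w
occ-∷-≢ {i} {x} w x≢i = cong length (filter-reject (_≟ i) {x} {w} x≢i)

occ-++ : ∀ i xs ys → occ i (xs ++ ys) ≡ occ i xs + occ i ys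
occ-++ i xs ys = trans (cong length (filter-++ (_≟ i) xs ys)) (length-++ (filter (_≟ i) xs))

occ-reverse : ∀ i w → occ i (reverse w) ≡ occ i w
occ-reverse i []      = refl
occ-reverse i (x ∷ w) = begin
  occ i (reverse (x ∷ w))        ≡⟨ cong (occ i) (unfold-reverse x w) ⟩
  occ i (reverse w ++ [ x ])     ≡⟨ occ-++ i (reverse w) [ x ] ⟩
  occ i (reverse w) + occ i [ x ] ≡⟨ cong (_+ occ i [ x ]) (occ-reverse i w) ⟩
  occ i w + occ i [ x ]          ≡⟨ +-comm (occ i w) _ ⟩
  occ i [ x ] + occ i w          ≡⟨ occ-++ i [ x ] w ⟨
  occ i (x ∷ w)                  ∎
  where open ≡-Reasoning

-- Whether the letter x may be appended to the word reverse rs.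
Admissible : List ℕ → ℕ → Set
Admissible rs zero          = ⊥
Admissible rs (suc zero)    = ⊤
Admissible rs (suc (suc r)) = occ (suc (suc r)) rs < occ (suc r) rs

-- A reversed word rs is Yamanouchi when reverse rs is reverse Yamanouchi.
Yamanouchi : List ℕ → Set
Yamanouchi []       = ⊤
Yamanouchi (x ∷ rs) = Admissible rs x × Yamanouchi rs

Yamanouchi⇒positive : ∀ rs → Yamanouchi rs → All (1 ≤_) rs
Yamanouchi⇒positive []            _         = []
Yamanouchi⇒positive (suc x ∷ rs) (_ , yrs) = s≤s z≤n ∷ Yamanouchi⇒positive rs yrs

Balanced : Word → Set
Balanced w = ∀ i → 1 ≤ i → occ (suc i) w ≤ occ i w

PrefixBalanced : Word → Set
PrefixBalanced w = ∀ m → Balanced (take m w)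

take-∷ʳ : ∀ m (xs : Word) x → take m (xs ∷ʳ x) ≡ take m xs ⊎ take m (xs ∷ʳ x) ≡ xs ∷ʳ x
take-∷ʳ zero          xs       x = inj₁ refl
take-∷ʳ (suc zero)    []       x = inj₂ refl
take-∷ʳ (suc (suc m)) []       x = inj₂ refl
take-∷ʳ (suc m)       (y ∷ xs) x with take-∷ʳ m xs x
... | inj₁ eq = inj₁ (cong (y ∷_) eq)
... | inj₂ eq = inj₂ (cong (y ∷_) eq)

take-prefix-∷ʳ : ∀ m (xs : Word) x → ∃ λ m′ → take m xs ≡ take m′ (xs ∷ʳ x)
take-prefix-∷ʳ zero    xs       x = 0 , refl
take-prefix-∷ʳ (suc m) []       x = 0 , refl
take-prefix-∷ʳ (suc m) (y ∷ xs) x = let m′ , eq = take-prefix-∷ʳ m xs x in suc m′ , cong (y ∷_) eq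

prefixBalanced⇒balanced : ∀ w → PrefixBalanced w → Balanced w
prefixBalanced⇒balanced w pb = subst Balanced (take-all (length w) w ≤-refl) (pb (length w))

prefixBalanced-∷ʳ : ∀ xs x → PrefixBalanced xs → Balanced (xs ∷ʳ x) → PrefixBalanced (xs ∷ʳ x)
prefixBalanced-∷ʳ xs x pb b m with take-∷ʳ m xs x
... | inj₁ eq rewrite eq = pb m
... | inj₂ eq rewrite eq = b

prefixBalanced-∷ʳ⁻ : ∀ xs x → PrefixBalanced (xs ∷ʳ x) → PrefixBalanced xs
prefixBalanced-∷ʳ⁻ xs x pb m with take-prefix-∷ʳ m xs x
... | m′ , eq rewrite eq = pb m′

private
  occ-singleton-≡ : ∀ i → occ i [ i ] ≡ 1
  occ-singleton-≡ i = occ-∷-≡ i []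

  occ-singleton-≢ : ∀ {i x} → x ≢ i → occ i [ x ] ≡ 0
  occ-singleton-≢ = occ-∷-≢ []

  n≢1+n : ∀ n → n ≢ suc n
  n≢1+n n = <⇒≢ (n<1+n n)

balanced-∷ʳ : ∀ rs x → Balanced (reverse rs) → Admissible rs x → Balanced (reverse rs ∷ʳ x)
balanced-∷ʳ rs x b adm i 1≤i rewrite occ-++ (suc i) (reverse rs) [ x ] | occ-++ i (reverse rs) [ x ]
  with x ≟ suc i
... | yes refl rewrite occ-singleton-≡ (suc i) | occ-singleton-≢ (n≢1+n i ∘ sym) = step i 1≤i adm
  where
    step : ∀ i → 1 ≤ i → Admissible rs (suc i) → occ (suc i) (reverse rs) + 1 ≤ occ i (reverse rs) + 0
    step (suc i) _ adm rewrite occ-reverse (suc (suc i)) rs | occ-reverse (suc i) rs =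
      subst₂ _≤_ (+-comm 1 _) (sym (+-identityʳ _)) adm
... | no x≢1+i with x ≟ i
...   | yes refl rewrite occ-singleton-≢ (n≢1+n x) | occ-singleton-≡ x =
        ≤-trans (≤-reflexive (+-identityʳ _)) (≤-trans (b x 1≤i) (m≤m+n _ 1))
...   | no x≢i rewrite occ-singleton-≢ x≢1+i | occ-singleton-≢ x≢i = +-monoˡ-≤ 0 (b i 1≤i)

balanced-∷ʳ⁻ : ∀ rs x → 1 ≤ x → Balanced (reverse rs ∷ʳ x) → Admissible rs x
balanced-∷ʳ⁻ rs (suc zero)    _ _ = tt
balanced-∷ʳ⁻ rs (suc (suc r)) _ b
  with b (suc r) (s≤s z≤n)
... | occ≤ rewrite occ-++ (suc (suc r)) (reverse rs) [ suc (suc r) ] | occ-++ (suc r) (reverse rs) [ suc (suc r) ]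
                 | occ-singleton-≡ (suc (suc r)) | occ-singleton-≢ (n≢1+n (suc r) ∘ sym)
                 | occ-reverse (suc (suc r)) rs | occ-reverse (suc r) rs =
  subst₂ _≤_ (+-comm _ 1) (+-identityʳ _) occ≤

Yamanouchi⇒prefixBalanced : ∀ rs → Yamanouchi rs → PrefixBalanced (reverse rs)
Yamanouchi⇒prefixBalanced []       _           m = subst Balanced (sym (take-[] m)) (λ _ _ → z≤n)
  where take-[] : ∀ m → take m [] ≡ []
        take-[] zero    = refl
        take-[] (suc m) = refl
Yamanouchi⇒prefixBalanced (x ∷ rs) (adm , yrs) rewrite unfold-reverse x rs =
  prefixBalanced-∷ʳ (reverse rs) x pb (balanced-∷ʳ rs x (prefixBalanced⇒balanced (reverse rs) pb) adm)
  where pb = Yamanouchi⇒prefixBalanced rs yrs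

prefixBalanced⇒Yamanouchi : ∀ rs → All (1 ≤_) rs → PrefixBalanced (reverse rs) → Yamanouchi rs
prefixBalanced⇒Yamanouchi []       _            _  = tt
prefixBalanced⇒Yamanouchi (x ∷ rs) (1≤x ∷ pos) pb rewrite unfold-reverse x rs =
  balanced-∷ʳ⁻ rs x 1≤x (prefixBalanced⇒balanced (reverse rs ∷ʳ x) pb) ,
  prefixBalanced⇒Yamanouchi rs pos (prefixBalanced-∷ʳ⁻ (reverse rs) x pb)

-- Whether appending x to the word reverse rs creates a descent.
newDescent : ℕ → List ℕ → ℕ
newDescent x []      = 0
newDescent x (y ∷ _) = if x ≤ᵇ y then 1 else 0

desʳ : List ℕ → ℕ
desʳ []       = 0
desʳ (x ∷ rs) = newDescent x rs + desʳ rs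

des-∷ʳ : ∀ xs b a → des ((xs ∷ʳ b) ∷ʳ a) ≡ des (xs ∷ʳ b) + newDescent a [ b ]
des-∷ʳ []           b a = +-comm (newDescent a [ b ]) 0
des-∷ʳ (c ∷ [])     b a = trans (cong (newDescent b [ c ] +_) (+-identityʳ _)) (cong (_+ newDescent a [ b ]) (sym (+-identityʳ _)))
des-∷ʳ (c ∷ d ∷ xs) b a = trans (cong (newDescent d [ c ] +_) (des-∷ʳ (d ∷ xs) b a)) (sym (+-assoc (newDescent d [ c ]) _ _))

des-reverse : ∀ rs → des (reverse rs) ≡ desʳ rs
des-reverse []           = refl
des-reverse (a ∷ [])     = refl
des-reverse (a ∷ b ∷ rs) = begin
  des (reverse (a ∷ b ∷ rs))                  ≡⟨ cong des (unfold-reverse a (b ∷ rs)) ⟩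
  des (reverse (b ∷ rs) ∷ʳ a)                 ≡⟨ cong (λ w → des (w ∷ʳ a)) (unfold-reverse b rs) ⟩
  des ((reverse rs ∷ʳ b) ∷ʳ a)                ≡⟨ des-∷ʳ (reverse rs) b a ⟩
  des (reverse rs ∷ʳ b) + newDescent a [ b ]  ≡⟨ cong (λ w → des w + newDescent a [ b ]) (unfold-reverse b rs) ⟨
  des (reverse (b ∷ rs)) + newDescent a [ b ] ≡⟨ cong (_+ newDescent a [ b ]) (des-reverse (b ∷ rs)) ⟩
  desʳ (b ∷ rs) + newDescent a [ b ]          ≡⟨ +-comm (desʳ (b ∷ rs)) _ ⟩
  desʳ (a ∷ b ∷ rs)                           ∎
  where open ≡-Reasoning

All-reverse : ∀ {P : A → Set} {xs} → All P xs → All P (reverse xs)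
All-reverse pxs = All.tabulate (All.lookup pxs ∘ Any.reverse⁻)

IsRY⇒Yamanouchi : ∀ {n k w} → IsRY n k w → length (reverse w) ≡ n × Yamanouchi (reverse w) × desʳ (reverse w) ≡ k
IsRY⇒Yamanouchi {w = w} (refl , (pos , pb) , refl) =
  length-reverse w ,
  prefixBalanced⇒Yamanouchi (reverse w) (All-reverse pos) (subst PrefixBalanced (sym (reverse-involutive w)) pb) ,
  trans (sym (des-reverse (reverse w))) (cong des (reverse-involutive w))

Yamanouchi⇒IsRY : ∀ rs → Yamanouchi rs → IsRY (length rs) (desʳ rs) (reverse rs)
Yamanouchi⇒IsRY rs yrs =
  length-reverse rs , (All-reverse (Yamanouchi⇒positive rs yrs) , Yamanouchi⇒prefixBalanced rs yrs) , des-reverse rs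

-- Labellings of a reversed word

Pair : Set
Pair = ℕ × ℕ

_<ₗ_ _≤ₗ_ : Pair → Pair → Set
_<ₗ_ = ×-Lex _≡_ _<_ _<_
_≤ₗ_ = ×-Lex _≡_ _<_ _≤_

LexDecreasing : List Pair → Set
LexDecreasing = Linked (flip _<ₗ_)

rows : List Pair → List ℕ
rows = map proj₂

-- ps = (v₁ , x₁) ∷ (v₂ , x₂) ∷ ⋯ attaches entries v₁ ≥ v₂ ≥ ⋯ in {1,…,hi} to the letters
-- x₁ ∷ x₂ ∷ ⋯ of rs, strictly decreasing at each descent of reverse rs.
Labelling : List ℕ → ℕ → List Pair → Set
Labelling []       hi []             = ⊤
Labelling (x ∷ rs) hi ((v , y) ∷ ps) = y ≡ x × InRange hi v × Labelling rs (v ∸ newDescent x rs) ps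
Labelling _        _  _              = ⊥

labellings : List ℕ → ℕ → List (List Pair)
labellings []       _        = [ [] ]
labellings (x ∷ rs) zero     = []
labellings (x ∷ rs) (suc hi) =
  labellings (x ∷ rs) hi ++ map ((suc hi , x) ∷_) (labellings rs (suc hi ∸ newDescent x rs))

length-labellings-suc : ∀ x rs hi → length (labellings (x ∷ rs) (suc hi)) ≡
  length (labellings (x ∷ rs) hi) + length (labellings rs (suc hi ∸ newDescent x rs))
length-labellings-suc x rs hi =
  trans (length-++ (labellings (x ∷ rs) hi))
        (cong (length (labellings (x ∷ rs) hi) +_) (length-map ((suc hi , x) ∷_) (labellings rs (suc hi ∸ newDescent x rs))))

labellings-empty : ∀ x rs hi → hi ≤ desʳ (x ∷ rs) → labellings (x ∷ rs) hi ≡ []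
labellings-empty x rs       zero     _  = refl
labellings-empty x []       (suc hi) ()
labellings-empty x (y ∷ rs) (suc hi) le =
  cong₂ (λ l l′ → l ++ map ((suc hi , x) ∷_) l′)
    (labellings-empty x (y ∷ rs) hi (≤-trans (n≤1+n hi) le))
    (labellings-empty y rs (suc hi ∸ newDescent x (y ∷ rs)) (m≤n+o⇒m∸n≤o (suc hi) (newDescent x (y ∷ rs)) le))

-- Pascal's rule, splitting on whether the first entry is the largest allowed one: removing the
-- d forced strict descents leaves weakly decreasing sequences of length n in {1,…,1+h}.
length-labellings : ∀ rs h → length (labellings rs (suc (desʳ rs + h))) ≡ (length rs + h) C h
length-labellings []       h = sym (nCn≡1 h)
length-labellings (x ∷ rs) h = count h
  where
    d = newDescent x rs
    D = desʳ (x ∷ rs)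
    L = length rs

    shift : ∀ j → suc (D + j) ∸ d ≡ suc (desʳ rs + j)
    shift j = trans (cong (λ i → suc i ∸ d) (+-assoc d (desʳ rs) j))
                    (trans (cong (_∸ d) (sym (+-suc d _))) (m+n∸m≡n d _))

    count : ∀ h → length (labellings (x ∷ rs) (suc (D + h))) ≡ (suc L + h) C h
    count zero = begin
      length (labellings (x ∷ rs) (suc (D + 0)))           ≡⟨ cong (λ i → length (labellings (x ∷ rs) (suc i))) (+-identityʳ D) ⟩
      length (labellings (x ∷ rs) (suc D))                 ≡⟨ length-labellings-suc x rs D ⟩
      length (labellings (x ∷ rs) D) + length (labellings rs (suc D ∸ d))
        ≡⟨ cong₂ (λ l i → length l + length (labellings rs i)) (labellings-empty x rs D ≤-refl)
                 (trans (cong (λ i → suc i ∸ d) (sym (+-identityʳ D))) (shift 0)) ⟩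
      length (labellings rs (suc (desʳ rs + 0)))           ≡⟨ length-labellings rs 0 ⟩
      1                                                    ∎
      where open ≡-Reasoning
    count (suc h) = begin
      length (labellings (x ∷ rs) (suc (D + suc h)))       ≡⟨ cong (λ i → length (labellings (x ∷ rs) (suc i))) (+-suc D h) ⟩
      length (labellings (x ∷ rs) (suc (suc (D + h))))     ≡⟨ length-labellings-suc x rs (suc (D + h)) ⟩
      length (labellings (x ∷ rs) (suc (D + h))) + length (labellings rs (suc (suc (D + h)) ∸ d))
        ≡⟨ cong₂ (λ m i → m + length (labellings rs i)) (count h)
                 (trans (cong (λ i → suc i ∸ d) (sym (+-suc D h))) (shift (suc h))) ⟩
      (suc L + h) C h + length (labellings rs (suc (desʳ rs + suc h)))
        ≡⟨ cong ((suc L + h) C h +_) (length-labellings rs (suc h)) ⟩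
      (suc L + h) C h + (L + suc h) C suc h                ≡⟨ cong (λ i → (suc L + h) C h + i C suc h) (+-suc L h) ⟩
      (suc L + h) C h + (suc L + h) C suc h                ≡⟨ nCk+nC[k+1]≡[n+1]C[k+1] (suc L + h) h ⟩
      suc (suc L + h) C suc h                              ≡⟨ cong (_C suc h) (+-suc (suc L) h) ⟨
      (suc L + suc h) C suc h                              ∎
      where open ≡-Reasoning

Labelling-mono : ∀ rs {hi hi′} ps → hi ≤ hi′ → Labelling rs hi ps → Labelling rs hi′ ps
Labelling-mono []       []             _     _                        = tt
Labelling-mono (x ∷ rs) ((v , y) ∷ ps) hi≤hi′ (y≡x , (1≤v , v≤hi) , l) = y≡x , (1≤v , ≤-trans v≤hi hi≤hi′) , l

labellings-sound : ∀ rs hi {ps} → ps ∈ labellings rs hi → Labelling rs hi ps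
labellings-sound []       hi       (here refl) = tt
labellings-sound (x ∷ rs) (suc hi) ps∈ with ∈-++⁻ (labellings (x ∷ rs) hi) ps∈
... | inj₁ ps∈′ = Labelling-mono (x ∷ rs) _ (n≤1+n hi) (labellings-sound (x ∷ rs) hi ps∈′)
... | inj₂ ps∈′ with ∈-map⁻ ((suc hi , x) ∷_) ps∈′
...   | qs , qs∈ , refl = refl , (s≤s z≤n , ≤-refl) , labellings-sound rs _ qs∈

labellings-complete : ∀ rs hi {ps} → Labelling rs hi ps → ps ∈ labellings rs hi
labellings-∷-complete : ∀ x rs hi v {ps} → InRange hi v → Labelling rs (v ∸ newDescent x rs) ps →
  ((v , x) ∷ ps) ∈ labellings (x ∷ rs) hi

labellings-complete []       hi {[]}            _                 = here refl
labellings-complete (x ∷ rs) hi {(v , .x) ∷ ps} (refl , v∈ , l) = labellings-∷-complete x rs hi v v∈ l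

labellings-∷-complete x rs zero     v (1≤v , v≤0)    l = ⊥-elim (<⇒≱ 1≤v v≤0)
labellings-∷-complete x rs (suc hi) v (1≤v , v≤1+hi) l with m≤n⇒m<n∨m≡n v≤1+hi
... | inj₁ v<1+hi = ∈-++⁺ˡ (labellings-∷-complete x rs hi v (1≤v , s≤s⁻¹ v<1+hi) l)
... | inj₂ refl   = ∈-++⁺ʳ (labellings (x ∷ rs) hi) (∈-map⁺ ((suc hi , x) ∷_) (labellings-complete rs _ l))

labellings-unique : ∀ rs hi → Unique (labellings rs hi)
labellings-unique []       hi       = [] ∷ Unique.[]
labellings-unique (x ∷ rs) zero     = Unique.[]
labellings-unique (x ∷ rs) (suc hi) =
  Unique.++⁺ (labellings-unique (x ∷ rs) hi) (Unique.map⁺ ∷-injectiveʳ (labellings-unique rs _)) disjoint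
  where
    disjoint : ∀ {ps} → ps ∈ labellings (x ∷ rs) hi × ps ∈ map ((suc hi , x) ∷_) (labellings rs _) → ⊥
    disjoint (ps∈ , ps∈′) with labellings-sound (x ∷ rs) hi ps∈ | ∈-map⁻ ((suc hi , x) ∷_) ps∈′
    ... | _ , (_ , 1+hi≤hi) , _ | _ , _ , refl = <-irrefl refl 1+hi≤hi

newDescent-cases : ∀ x y rs → (x ≤ y × newDescent x (y ∷ rs) ≡ 1) ⊎ (y < x × newDescent x (y ∷ rs) ≡ 0)
newDescent-cases x y rs with x ≤ᵇ y in eq
... | true  = inj₁ (≤ᵇ⇒≤ x y (subst Bool.T (sym eq) tt) , refl)
... | false = inj₂ (≰⇒> (λ x≤y → subst Bool.T eq (≤⇒≤ᵇ x≤y)) , refl)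

labelStep⇒<ₗ : ∀ {v w x y} rs → 1 ≤ v → w ≤ v ∸ newDescent x (y ∷ rs) → (w , y) <ₗ (v , x)
labelStep⇒<ₗ {suc v} {w} {x} {y} rs _ w≤ with newDescent-cases x y rs
... | inj₁ (_ , eq) = inj₁ (s≤s (subst (λ d → w ≤ suc v ∸ d) eq w≤))
... | inj₂ (y<x , eq) with m≤n⇒m<n∨m≡n (subst (λ d → w ≤ suc v ∸ d) eq w≤)
...   | inj₁ w<v = inj₁ w<v
...   | inj₂ w≡v = inj₂ (w≡v , y<x)

<ₗ⇒labelStep : ∀ {v w x y} rs → (w , y) <ₗ (v , x) → w ≤ v ∸ newDescent x (y ∷ rs)
<ₗ⇒labelStep {v} {w} {x} {y} rs w,y<v,x with newDescent-cases x y rs | w,y<v,x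
... | inj₁ (_ , eq)   | inj₁ w<v          =
  subst (λ d → w ≤ v ∸ d) (sym eq) (subst (w ≤_) (pred[m∸n]≡m∸[1+n] v 0) (<⇒≤pred w<v))
... | inj₁ (x≤y , _)  | inj₂ (_ , y<x)    = ⊥-elim (<⇒≱ y<x x≤y)
... | inj₂ (_ , eq)   | inj₁ w<v          = subst (λ d → w ≤ v ∸ d) (sym eq) (<⇒≤ w<v)
... | inj₂ (_ , eq)   | inj₂ (refl , _)   = subst (λ d → w ≤ v ∸ d) (sym eq) ≤-refl

Labelling⇒LexDecreasing : ∀ rs hi ps → Labelling rs hi ps →
  rows ps ≡ rs × All (InRange hi ∘ proj₁) ps × LexDecreasing ps
Labelling⇒LexDecreasing []       hi []              _                         = refl , [] , []
Labelling⇒LexDecreasing (x ∷ rs) hi ((v , .x) ∷ ps) (refl , (1≤v , v≤hi) , l)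
  with Labelling⇒LexDecreasing rs (v ∸ newDescent x rs) ps l
... | rows≡ , inRange , dec =
  cong (x ∷_) rows≡ ,
  (1≤v , v≤hi) ∷ All.map (λ (1≤w , w≤) → 1≤w , ≤-trans w≤ (≤-trans (m∸n≤m v (newDescent x rs)) v≤hi)) inRange ,
  linked rs ps l dec
  where
    linked : ∀ rs ps → Labelling rs (v ∸ newDescent x rs) ps → LexDecreasing ps → LexDecreasing ((v , x) ∷ ps)
    linked []       []              _                    _   = [-]
    linked (y ∷ rs) ((w , .y) ∷ ps) (refl , (_ , w≤) , _) dec = labelStep⇒<ₗ rs 1≤v w≤ ∷ dec

private
  HeadAtMost : ℕ → List Pair → Set
  HeadAtMost hi []            = ⊤
  HeadAtMost hi ((v , _) ∷ _) = v ≤ hi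

  lexDecreasing⇒Labelling : ∀ rs hi ps → rows ps ≡ rs → All ((1 ≤_) ∘ proj₁) ps → HeadAtMost hi ps →
    LexDecreasing ps → Labelling rs hi ps
  lexDecreasing⇒Labelling []       hi []             refl _            _    _   = tt
  lexDecreasing⇒Labelling (x ∷ rs) hi ((v , x) ∷ ps) refl (1≤v ∷ pos) v≤hi dec =
    refl , (1≤v , v≤hi) , lexDecreasing⇒Labelling rs _ ps refl pos (next≤ ps dec) (Linked.tail dec)
    where
      next≤ : ∀ ps → LexDecreasing ((v , x) ∷ ps) → HeadAtMost (v ∸ newDescent x (rows ps)) ps
      next≤ []             _        = tt
      next≤ ((w , y) ∷ ps) (lt ∷ _) = <ₗ⇒labelStep (rows ps) lt

LexDecreasing⇒Labelling : ∀ hi ps → All (InRange hi ∘ proj₁) ps → LexDecreasing ps → Labelling (rows ps) hi ps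
LexDecreasing⇒Labelling hi ps inRange =
  lexDecreasing⇒Labelling (rows ps) hi ps refl (All.map proj₁ inRange) (headAtMost inRange)
  where
    headAtMost : ∀ {ps} → All (InRange hi ∘ proj₁) ps → HeadAtMost hi ps
    headAtMost []               = tt
    headAtMost ((_ , v≤hi) ∷ _) = v≤hi

-- Tableaux grown one cell at a time

length-∷ʳ : ∀ (xs : List ℕ) x → length (xs ∷ʳ x) ≡ suc (length xs)
length-∷ʳ xs x = trans (length-++ xs) (+-comm (length xs) 1)

∷ʳ-⊒ : ∀ {xs ys} v → xs ⊒ ys → (xs ∷ʳ v) ⊒ ys
∷ʳ-⊒ v below-[]         = below-[]
∷ʳ-⊒ v (below-∷ x≤y xs⊒ys) = below-∷ x≤y (∷ʳ-⊒ v xs⊒ys)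

∷ʳ-⊒⁻ : ∀ xs {ys} v → (xs ∷ʳ v) ⊒ ys → All (_< v) ys → xs ⊒ ys
∷ʳ-⊒⁻ []       v below-[]                  _          = below-[]
∷ʳ-⊒⁻ []       v (below-∷ v≤y below-[])    (y<v ∷ _)  = ⊥-elim (<⇒≱ y<v v≤y)
∷ʳ-⊒⁻ (x ∷ xs) v below-[]                  _          = below-[]
∷ʳ-⊒⁻ (x ∷ xs) v (below-∷ x≤y xs⊒ys)       (_ ∷ ys<v) = below-∷ x≤y (∷ʳ-⊒⁻ xs v xs⊒ys ys<v)

⊒-∷ʳ : ∀ {xs ys} v → xs ⊒ ys → length ys < length xs → All (_≤ v) xs → xs ⊒ (ys ∷ʳ v)
⊒-∷ʳ v (below-[] {_ ∷ _}) _         (x≤v ∷ _)  = below-∷ x≤v below-[]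
⊒-∷ʳ v (below-∷ x≤y xs⊒ys) (s≤s lt) (_ ∷ xs≤v) = below-∷ x≤y (⊒-∷ʳ v xs⊒ys lt xs≤v)

⊒-∷ʳ⁻ : ∀ {xs} ys v → xs ⊒ (ys ∷ʳ v) → xs ⊒ ys
⊒-∷ʳ⁻ []       v _                    = below-[]
⊒-∷ʳ⁻ (y ∷ ys) v (below-∷ x≤y xs⊒ys) = below-∷ x≤y (⊒-∷ʳ⁻ ys v xs⊒ys)

⊒-length : ∀ {xs ys} → xs ⊒ ys → length ys ≤ length xs
⊒-length below-[]           = z≤n
⊒-length (below-∷ _ xs⊒ys) = s≤s (⊒-length xs⊒ys)

Linked<-∷ʳ : ∀ xs v → Linked _<_ xs → All (_< v) xs → Linked _<_ (xs ∷ʳ v)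
Linked<-∷ʳ []           v _         _         = [-]
Linked<-∷ʳ (x ∷ [])     v _         (x<v ∷ _) = x<v ∷ [-]
Linked<-∷ʳ (x ∷ y ∷ xs) v (x<y ∷ l) (_ ∷ xs<v) = x<y ∷ Linked<-∷ʳ (y ∷ xs) v l xs<v

Linked<-∷ʳ⁻ : ∀ xs v → Linked _<_ (xs ∷ʳ v) → Linked _<_ xs × All (_< v) xs
Linked<-∷ʳ⁻ []           v _         = [] , []
Linked<-∷ʳ⁻ (x ∷ [])     v (x<v ∷ _) = [-] , x<v ∷ []
Linked<-∷ʳ⁻ (x ∷ y ∷ xs) v (x<y ∷ l) with Linked<-∷ʳ⁻ (y ∷ xs) v l
... | l′ , ys<v@(y<v ∷ _) = x<y ∷ l′ , <-trans x<y y<v ∷ ys<v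

IsTableau : Tableau → Set
IsTableau T = All NonEmpty T × All (Linked _<_) T × Linked _⊒_ T

HeadBelow : List ℕ → Tableau → Set
HeadBelow row T = Connected _⊒_ (just row) (head T)

IsTableau-tail : ∀ {row T} → IsTableau (row ∷ T) → IsTableau T
IsTableau-tail (_ ∷ nes , _ ∷ incs , cols) = nes , incs , Linked.tail cols

rowAt : Tableau → ℕ → List ℕ
rowAt []        _       = []
rowAt (row ∷ T) zero    = row
rowAt (row ∷ T) (suc i) = rowAt T i

rowLength : Tableau → ℕ → ℕ
rowLength T i = length (rowAt T i)

-- The entry v is appended to row r; when r is the number of rows, it starts a new row.
add : ℕ → ℕ → Tableau → Tableau
add zero    v []        = [ v ] ∷ []
add zero    v (row ∷ T) = (row ∷ʳ v) ∷ T
add (suc r) v []        = [ v ] ∷ []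
add (suc r) v (row ∷ T) = row ∷ add r v T

Extendable : Tableau → ℕ → Set
Extendable T zero    = ⊤
Extendable T (suc r) = rowLength T (suc r) < rowLength T r

Extendable-tail : ∀ row T r → Extendable (row ∷ T) (suc r) → Extendable T r
Extendable-tail row T zero    _   = tt
Extendable-tail row T (suc r) ext = ext

-- AllCells P o T: every entry e in row i of T satisfies P (e , i), rows being numbered from o.
AllCells : (Pair → Set) → ℕ → Tableau → Set
AllCells P o []        = ⊤
AllCells P o (row ∷ T) = All (λ e → P (e , o)) row × AllCells P (suc o) T

AllCells-rowAt : ∀ {P} o T i → AllCells P o T → All (λ e → P (e , i + o)) (rowAt T i)
AllCells-rowAt o []        i       _            = []
AllCells-rowAt o (row ∷ T) zero    (row-P , _)  = row-P
AllCells-rowAt {P} o (row ∷ T) (suc i) (_ , T-P) =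
  subst (λ j → All (λ e → P (e , j)) (rowAt T i)) (+-suc i o) (AllCells-rowAt (suc o) T i T-P)

AllCells-map : ∀ {P Q} o T → (∀ {e i} → o ≤ i → P (e , i) → Q (e , i)) → AllCells P o T → AllCells Q o T
AllCells-map o []        P⇒Q _             = tt
AllCells-map o (row ∷ T) P⇒Q (row-P , T-P) =
  All.map (P⇒Q ≤-refl) row-P , AllCells-map (suc o) T (P⇒Q ∘ ≤-trans (n≤1+n o)) T-P

AllCells-shift : ∀ {P Q} o T → (∀ {e i} → P (e , i) → Q (e , suc i)) → AllCells P o T → AllCells Q (suc o) T
AllCells-shift o []        P⇒Q _             = tt
AllCells-shift o (row ∷ T) P⇒Q (row-P , T-P) = All.map P⇒Q row-P , AllCells-shift (suc o) T P⇒Q T-P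

AllCells⇒All : ∀ {Q : ℕ → Set} o T → AllCells (Q ∘ proj₁) o T → All (All Q) T
AllCells⇒All o []        _             = []
AllCells⇒All o (row ∷ T) (row-Q , T-Q) = row-Q ∷ AllCells⇒All (suc o) T T-Q

All⇒AllCells : ∀ {Q : ℕ → Set} o T → All (All Q) T → AllCells (Q ∘ proj₁) o T
All⇒AllCells o []        _             = tt
All⇒AllCells o (row ∷ T) (row-Q ∷ T-Q) = row-Q , All⇒AllCells (suc o) T T-Q

add≢[] : ∀ r v T → add r v T ≢ []
add≢[] zero    v []      ()
add≢[] zero    v (_ ∷ _) ()
add≢[] (suc r) v []      ()
add≢[] (suc r) v (_ ∷ _) ()

add-AllCells : ∀ {P} o r T v → Extendable T r → AllCells P o T → P (v , r + o) → AllCells P o (add r v T)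
add-AllCells o zero    []        v _   _             Pv = Pv ∷ [] , tt
add-AllCells o zero    (row ∷ T) v _   (row-P , T-P) Pv = All.∷ʳ⁺ row-P Pv , T-P
add-AllCells {P} o (suc r) (row ∷ T) v ext (row-P , T-P) Pv =
  row-P , add-AllCells (suc o) r T v (Extendable-tail row T r ext) T-P (subst (λ i → P (v , i)) (sym (+-suc r o)) Pv)

cells-add : ∀ r T v → Extendable T r → cells (add r v T) ≡ suc (cells T)
cells-add zero    []        v _   = refl
cells-add zero    (row ∷ T) v _   = cong (_+ cells T) (length-∷ʳ row v)
cells-add (suc r) (row ∷ T) v ext =
  trans (cong (length row +_) (cells-add r T v (Extendable-tail row T r ext))) (+-suc (length row) _)

rowLength-add-≡ : ∀ r T v → Extendable T r → rowLength (add r v T) r ≡ suc (rowLength T r)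
rowLength-add-≡ zero    []        v _   = refl
rowLength-add-≡ zero    (row ∷ T) v _   = length-∷ʳ row v
rowLength-add-≡ (suc r) (row ∷ T) v ext = rowLength-add-≡ r T v (Extendable-tail row T r ext)

rowLength-add-≢ : ∀ r T v i → Extendable T r → i ≢ r → rowLength (add r v T) i ≡ rowLength T i
rowLength-add-≢ zero    []        v zero    _   i≢r = ⊥-elim (i≢r refl)
rowLength-add-≢ zero    []        v (suc i) _   _   = refl
rowLength-add-≢ zero    (row ∷ T) v zero    _   i≢r = ⊥-elim (i≢r refl)
rowLength-add-≢ zero    (row ∷ T) v (suc i) _   _   = refl
rowLength-add-≢ (suc r) (row ∷ T) v zero    _   _   = refl
rowLength-add-≢ (suc r) (row ∷ T) v (suc i) ext i≢r =
  rowLength-add-≢ r T v i (Extendable-tail row T r ext) (i≢r ∘ cong suc)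

∈-add : ∀ r T v → Extendable T r → v ∈ rowAt (add r v T) r
∈-add zero    []        v _   = here refl
∈-add zero    (row ∷ T) v _   = ∈-++⁺ʳ row (here refl)
∈-add (suc r) (row ∷ T) v ext = ∈-add r T v (Extendable-tail row T r ext)

add-injective : ∀ r T T′ v → All NonEmpty T → All NonEmpty T′ → Extendable T r → Extendable T′ r →
  add r v T ≡ add r v T′ → T ≡ T′
add-injective zero    []          []           v _         _           _   _    _  = refl
add-injective zero    []          (row′ ∷ T′) v _         (ne′ ∷ _)   _   _    eq =
  ⊥-elim (<⇒≱ ne′ (≤-reflexive (cong length (sym (proj₁ (∷ʳ-injective [] row′ (proj₁ (∷-injective eq))))))))
add-injective zero    (row ∷ T)   []           v (ne ∷ _)  _           _   _    eq =
  ⊥-elim (<⇒≱ ne (≤-reflexive (cong length (proj₁ (∷ʳ-injective row [] (proj₁ (∷-injective eq)))))))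
add-injective zero    (row ∷ T)   (row′ ∷ T′) v _         _           _   _    eq
  with eq-row , refl ← ∷-injective eq = cong (_∷ T) (proj₁ (∷ʳ-injective row row′ eq-row))
add-injective (suc r) (row ∷ T)   (row′ ∷ T′) v (_ ∷ nes) (_ ∷ nes′) ext ext′ eq
  with refl , eq′ ← ∷-injective eq =
  cong (row ∷_) (add-injective r T T′ v nes nes′ (Extendable-tail row T r ext) (Extendable-tail row T′ r ext′) eq′)

add-IsTableau : ∀ r T v → IsTableau T → Extendable T r →
  All (_< v) (rowAt T r) → All (_≤ v) (rowAt T (pred r)) → IsTableau (add r v T)
add-IsTableau zero    []        v _ _ _ _ = s≤s z≤n ∷ [] , [-] ∷ [] , [-]
add-IsTableau zero    (row ∷ T) v (_ ∷ nes , inc ∷ incs , cols) _ row<v _ =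
  subst (1 ≤_) (sym (length-∷ʳ row v)) (s≤s z≤n) ∷ nes ,
  Linked<-∷ʳ row v inc row<v ∷ incs ,
  extend T (Linked.head′ cols) ∷′ Linked.tail cols
  where
    extend : ∀ T → HeadBelow row T → HeadBelow (row ∷ʳ v) T
    extend []        _           = just-nothing
    extend (_ ∷ _)   (just row⊒) = just (∷ʳ-⊒ v row⊒)
add-IsTableau (suc r) (row ∷ T) v tab@(ne ∷ _ , inc ∷ _ , cols) ext row<v above≤v
  with add-IsTableau r T v (IsTableau-tail tab) (Extendable-tail row T r ext) row<v (above r row<v above≤v)
  where
    above : ∀ r → All (_< v) (rowAt T r) → All (_≤ v) (rowAt (row ∷ T) r) → All (_≤ v) (rowAt T (pred r))
    above zero    row<v _       = All.map <⇒≤ row<v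
    above (suc r) _     above≤v = above≤v
... | nes , incs , cols′ = ne ∷ nes , inc ∷ incs , below r T ext above≤v (Linked.head′ cols) ∷′ cols′
  where
    single : ∀ row → NonEmpty row → All (_≤ v) row → row ⊒ [ v ]
    single (x ∷ _) _ (x≤v ∷ _) = below-∷ x≤v below-[]
    below : ∀ r T → Extendable (row ∷ T) (suc r) → All (_≤ v) (rowAt (row ∷ T) r) →
      HeadBelow row T → HeadBelow row (add r v T)
    below zero    []         _     row≤v _           = just (single row ne row≤v)
    below zero    (row₂ ∷ T) short row≤v (just row⊒) = just (⊒-∷ʳ v row⊒ short row≤v)
    below (suc r) (row₂ ∷ T) _     _     row⊒        = row⊒

-- From encodings to tableaux

<ₗ-pred : ∀ {v w a b} → (w , suc a) <ₗ (v , suc b) → (w , a) <ₗ (v , b)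
<ₗ-pred (inj₁ w<v)             = inj₁ w<v
<ₗ-pred (inj₂ (w≡v , s≤s a<b)) = inj₂ (w≡v , a<b)

≤ₗ-<ₗ-trans : ∀ {p q r} → p ≤ₗ q → q <ₗ r → p <ₗ r
≤ₗ-<ₗ-trans (inj₁ e<w)         (inj₁ w<v)         = inj₁ (<-trans e<w w<v)
≤ₗ-<ₗ-trans (inj₁ e<w)         (inj₂ (refl , _))  = inj₁ e<w
≤ₗ-<ₗ-trans (inj₂ (refl , _))  (inj₁ w<v)         = inj₁ w<v
≤ₗ-<ₗ-trans (inj₂ (refl , i≤a)) (inj₂ (refl , a<b)) = inj₂ (refl , ≤-<-trans i≤a a<b)

<ₗ⇒≤ₗ : ∀ {p q} → p <ₗ q → p ≤ₗ q
<ₗ⇒≤ₗ (inj₁ e<v)       = inj₁ e<v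
<ₗ⇒≤ₗ (inj₂ (e≡v , i<r)) = inj₂ (e≡v , <⇒≤ i<r)

-- Rows are numbered from 1 in encodings and from 0 in tableaux.
tableau : List Pair → Tableau
tableau []             = []
tableau ((v , x) ∷ ps) = add (pred x) v (tableau ps)

IsEncoding : ℕ → List Pair → Set
IsEncoding s ps = All (InRange s ∘ proj₁) ps × LexDecreasing ps × Yamanouchi (rows ps)

IsEncoding-tail : ∀ {s p} ps → IsEncoding s (p ∷ ps) → IsEncoding s ps
IsEncoding-tail []      (_ ∷ inRange , _       , _ , yam) = inRange , []  , yam
IsEncoding-tail (_ ∷ _) (_ ∷ inRange , _ ∷ dec , _ , yam) = inRange , dec , yam

RowLengths : List Pair → Set
RowLengths ps = ∀ i → rowLength (tableau ps) i ≡ occ (suc i) (rows ps)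

Admissible⇒Extendable : ∀ ps r → RowLengths ps → Admissible (rows ps) (suc r) → Extendable (tableau ps) r
Admissible⇒Extendable ps zero    _       _   = tt
Admissible⇒Extendable ps (suc r) lengths adm rewrite lengths (suc r) | lengths r = adm

Extendable⇒Admissible : ∀ ps r → RowLengths ps → Extendable (tableau ps) r → Admissible (rows ps) (suc r)
Extendable⇒Admissible ps zero    _       _   = tt
Extendable⇒Admissible ps (suc r) lengths ext rewrite lengths (suc r) | lengths r = ext

HeadIsMax : List Pair → Set
HeadIsMax []             = ⊤
HeadIsMax ((v , x) ∷ ps) = AllCells (_≤ₗ (v , pred x)) 0 (tableau ((v , x) ∷ ps))

record Invariant (s : ℕ) (ps : List Pair) : Set where
  field
    isTableau  : IsTableau (tableau ps)
    inRange    : AllCells (InRange s ∘ proj₁) 0 (tableau ps)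
    size       : cells (tableau ps) ≡ length ps
    rowLengths : RowLengths ps
    headIsMax  : HeadIsMax ps

below-head : ∀ v r ps → LexDecreasing ((v , suc r) ∷ ps) → Yamanouchi (rows ps) → HeadIsMax ps →
  AllCells (_<ₗ (v , r)) 0 (tableau ps)
below-head v r []                    _         _          _   = tt
below-head v r ((w , suc r₂) ∷ ps) (lt ∷ _) _          max =
  AllCells-map 0 (tableau ((w , suc r₂) ∷ ps)) (λ _ le → ≤ₗ-<ₗ-trans le (<ₗ-pred lt)) max

encoding-invariant : ∀ s ps → IsEncoding s ps → Invariant s ps
encoding-invariant s []                   _ = record
  { isTableau = [] , [] , [] ; inRange = tt ; size = refl ; rowLengths = λ _ → refl ; headIsMax = tt }
encoding-invariant s ((v , suc r) ∷ ps) enc@(v∈ ∷ _ , dec , adm , yam) = record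
  { isTableau  = add-IsTableau r T v isTableau ext
                   (All.map (strict r) (AllCells-rowAt 0 T r below))
                   (All.map <ₗ⇒≤ (AllCells-rowAt 0 T (pred r) below))
  ; inRange    = add-AllCells 0 r T v ext inRange v∈
  ; size       = trans (cells-add r T v ext) (cong suc size)
  ; rowLengths = rowLengths′
  ; headIsMax  = add-AllCells 0 r T v ext (AllCells-map 0 T (λ _ → <ₗ⇒≤ₗ) below) (inj₂ (refl , ≤-reflexive (+-identityʳ r)))
  }
  where
    open Invariant (encoding-invariant s ps (IsEncoding-tail ps enc))
    T = tableau ps
    ext : Extendable T r
    ext = Admissible⇒Extendable ps r rowLengths adm
    below : AllCells (_<ₗ (v , r)) 0 T
    below = below-head v r ps dec yam headIsMax
    strict : ∀ r {e} → (e , r + 0) <ₗ (v , r) → e < v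
    strict r (inj₁ e<v)        = e<v
    strict r (inj₂ (_ , r<r)) = ⊥-elim (<-irrefl (+-identityʳ r) r<r)
    <ₗ⇒≤ : ∀ {e i} → (e , i) <ₗ (v , r) → e ≤ v
    <ₗ⇒≤ (inj₁ e<v)        = <⇒≤ e<v
    <ₗ⇒≤ (inj₂ (refl , _)) = ≤-refl
    rowLengths′ : RowLengths ((v , suc r) ∷ ps)
    rowLengths′ i with i ≟ r
    ... | yes refl = trans (rowLength-add-≡ r T v ext) (trans (cong suc (rowLengths r)) (sym (occ-∷-≡ (suc r) (rows ps))))
    ... | no i≢r   = trans (rowLength-add-≢ r T v i ext i≢r)
                           (trans (rowLengths i) (sym (occ-∷-≢ (rows ps) (i≢r ∘ sym ∘ suc-injective))))

tableau-IsSSYT : ∀ s ps → IsEncoding s ps → IsSSYT (length ps) s (tableau ps)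
tableau-IsSSYT s ps enc = size , nes , AllCells⇒All 0 (tableau ps) inRange , incs , cols
  where open Invariant (encoding-invariant s ps enc)
        nes = proj₁ isTableau
        incs = proj₁ (proj₂ isTableau)
        cols = proj₂ (proj₂ isTableau)

head∈tableau : ∀ s v r ps → IsEncoding s ((v , suc r) ∷ ps) → v ∈ rowAt (tableau ((v , suc r) ∷ ps)) r
head∈tableau s v r ps enc@(_ , _ , adm , _) = ∈-add r (tableau ps) v (Admissible⇒Extendable ps r rowLengths adm)
  where open Invariant (encoding-invariant s ps (IsEncoding-tail ps enc))

-- The head of an encoding is the largest cell of its tableau, so it is determined by the tableau.
tableau-injective : ∀ s ps qs → IsEncoding s ps → IsEncoding s qs → tableau ps ≡ tableau qs → ps ≡ qs
tableau-injective s []                 []                 _ _ _ = refl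
tableau-injective s []                 ((v , x) ∷ qs)     _ _ eq = ⊥-elim (add≢[] (pred x) v (tableau qs) (sym eq))
tableau-injective s ((v , x) ∷ ps)     []                 _ _ eq = ⊥-elim (add≢[] (pred x) v (tableau ps) eq)
tableau-injective s ((v , suc r) ∷ ps) ((v′ , suc r′) ∷ qs) encp encq eq
  with All.lookup (AllCells-rowAt 0 _ r (Invariant.headIsMax (encoding-invariant s _ encq)))
         (subst (λ T → v ∈ rowAt T r) eq (head∈tableau s v r ps encp))
     | All.lookup (AllCells-rowAt 0 _ r′ (Invariant.headIsMax (encoding-invariant s _ encp)))
         (subst (λ T → v′ ∈ rowAt T r′) (sym eq) (head∈tableau s v′ r′ qs encq))
... | inj₁ v<v′          | inj₁ v′<v         = ⊥-elim (<-asym v<v′ v′<v)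
... | inj₁ v<v′          | inj₂ (refl , _)   = ⊥-elim (<-irrefl refl v<v′)
... | inj₂ (refl , _)    | inj₁ v′<v         = ⊥-elim (<-irrefl refl v′<v)
... | inj₂ (refl , r≤r′) | inj₂ (_ , r′≤r)
  with refl ← ≤-antisym (subst (_≤ r′) (+-identityʳ r) r≤r′) (subst (_≤ r) (+-identityʳ r′) r′≤r) =
  cong ((v , suc r) ∷_) (tableau-injective s ps qs encp′ encq′
    (add-injective r (tableau ps) (tableau qs) v (nonEmpty P) (nonEmpty Q) (extendable P encp) (extendable Q encq) eq))
  where
    encp′ = IsEncoding-tail ps encp
    encq′ = IsEncoding-tail qs encq
    P = encoding-invariant s ps encp′
    Q = encoding-invariant s qs encq′
    nonEmpty : ∀ {ps} → Invariant s ps → All NonEmpty (tableau ps)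
    nonEmpty inv = proj₁ (Invariant.isTableau inv)
    extendable : ∀ {ps} → Invariant s ps → IsEncoding s ((v , suc r) ∷ ps) → Extendable (tableau ps) r
    extendable {ps} inv (_ , _ , adm , _) = Admissible⇒Extendable ps r (Invariant.rowLengths inv) adm

-- From tableaux to encodings: removing the largest cell

AllCells-add⁻ : ∀ {P} o r T v → Extendable T r → AllCells P o (add r v T) → AllCells P o T
AllCells-add⁻ o zero    []        v _   _             = tt
AllCells-add⁻ o zero    (row ∷ T) v _   (row-P , T-P) = All.++⁻ˡ row row-P , T-P
AllCells-add⁻ o (suc r) (row ∷ T) v ext (row-P , T-P) = row-P , AllCells-add⁻ (suc o) r T v (Extendable-tail row T r ext) T-P

≤⇒≤ₗ : ∀ {e v} r → e ≤ v → (e , 0) ≤ₗ (v , r)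
≤⇒≤ₗ r e≤v with m≤n⇒m<n∨m≡n e≤v
... | inj₁ e<v = inj₁ e<v
... | inj₂ e≡v = inj₂ (e≡v , z≤n)

Linked<-∷ʳ⇒≤ : ∀ xs v → Linked _<_ (xs ∷ʳ v) → All (_≤ v) (xs ∷ʳ v)
Linked<-∷ʳ⇒≤ xs v inc = All.∷ʳ⁺ (All.map <⇒≤ (proj₂ (Linked<-∷ʳ⁻ xs v inc))) ≤-refl

≤ₗ⇒≤ : ∀ {e i v r} → (e , i) ≤ₗ (v , r) → e ≤ v
≤ₗ⇒≤ (inj₁ e<v)        = <⇒≤ e<v
≤ₗ⇒≤ (inj₂ (refl , _)) = ≤-refl

≤ₗ-suc : ∀ {e i v r} → (e , i) ≤ₗ (v , r) → (e , suc i) ≤ₗ (v , suc r)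
≤ₗ-suc (inj₁ e<v)         = inj₁ e<v
≤ₗ-suc (inj₂ (e≡v , i≤r)) = inj₂ (e≡v , s≤s i≤r)

largestCell : ∀ T → IsTableau T → T ≢ [] →
  ∃ λ v → ∃ λ r → ∃ λ l → rowAt T r ≡ l ∷ʳ v × AllCells (_≤ₗ (v , r)) 0 T
largestCell [] _ T≢[] = ⊥-elim (T≢[] refl)
largestCell (row ∷ []) (ne ∷ _ , inc ∷ _ , _) _ with initLast row
... | []      = ⊥-elim (<⇒≱ ne z≤n)
... | l ∷ʳ′ x = x , 0 , l , refl , All.map (≤⇒≤ₗ 0) (Linked<-∷ʳ⇒≤ l x inc) , tt
largestCell (row ∷ row₂ ∷ T) tab@(ne ∷ _ , inc ∷ _ , _) _
  with initLast row | largestCell (row₂ ∷ T) (IsTableau-tail tab) (λ ())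
... | []      | _ = ⊥-elim (<⇒≱ ne z≤n)
... | l ∷ʳ′ x | v , r , l′ , row≡ , T-max with v <? x
...   | yes v<x = x , 0 , l , refl , All.map (≤⇒≤ₗ 0) (Linked<-∷ʳ⇒≤ l x inc) ,
                  AllCells-shift 0 (row₂ ∷ T) (λ le → inj₁ (≤-<-trans (≤ₗ⇒≤ le) v<x)) T-max
...   | no  v≮x = v , suc r , l′ , row≡ ,
                  All.map (λ e≤x → ≤⇒≤ₗ (suc r) (≤-trans e≤x (≮⇒≥ v≮x))) (Linked<-∷ʳ⇒≤ l x inc) ,
                  AllCells-shift 0 (row₂ ∷ T) ≤ₗ-suc T-max

HeadBelow-add⁻ : ∀ row r v T → HeadBelow row (add r v T) → HeadBelow row T
HeadBelow-add⁻ row zero    v []         _          = just-nothing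
HeadBelow-add⁻ row zero    v (row₂ ∷ T) (just row⊒) = just (⊒-∷ʳ⁻ row₂ v row⊒)
HeadBelow-add⁻ row (suc r) v []         _          = just-nothing
HeadBelow-add⁻ row (suc r) v (row₂ ∷ T) row⊒       = row⊒

Removal : ℕ → ℕ → ℕ → ℕ → Tableau → Set
Removal o r R v T = ∃ λ T′ → T ≡ add r v T′ × IsTableau T′ × Extendable T′ r × AllCells (_<ₗ (v , R)) o T′

-- The first row of T has index o, so v ends row R = r + o.
removeLargest : ∀ o r R T v l → r + o ≡ R → IsTableau T → rowAt T r ≡ l ∷ʳ v →
  AllCells (_≤ₗ (v , R)) o T → Removal o r R v T
removeLargest o r R [] v l _ _ []≡l∷ʳv _ =
  ⊥-elim (0≢1+n (trans (cong length []≡l∷ʳv) (length-∷ʳ l v)))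
removeLargest o zero R (row ∷ []) v [] _ _ refl _ = [] , refl , ([] , [] , []) , tt , tt
removeLargest o zero R (row ∷ row₂ ∷ T) v [] refl (_ ∷ ne₂ ∷ _ , _ , [v]⊒row₂ ∷ _) refl (_ , row₂-max , _) =
  ⊥-elim (v-alone row₂ ne₂ [v]⊒row₂ row₂-max)
  where
    v-alone : ∀ row₂ → NonEmpty row₂ → [ v ] ⊒ row₂ → All (λ e → (e , suc o) ≤ₗ (v , o)) row₂ → ⊥
    v-alone (y ∷ _) _ (below-∷ v≤y _) (inj₁ y<v ∷ _)      = <⇒≱ y<v v≤y
    v-alone (y ∷ _) _ (below-∷ v≤y _) (inj₂ (_ , o<o) ∷ _) = <-irrefl refl o<o
removeLargest o zero .o (row ∷ T) v (a ∷ l) refl (_ ∷ nes , inc ∷ incs , cols) refl (_ , T-max) =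
  (a ∷ l) ∷ T , refl ,
  (s≤s z≤n ∷ nes , proj₁ (Linked<-∷ʳ⁻ (a ∷ l) v inc) ∷ incs ,
   shorten T (Linked.head′ cols) T-max ∷′ Linked.tail cols) ,
  tt , (All.map inj₁ (proj₂ (Linked<-∷ʳ⁻ (a ∷ l) v inc)) , AllCells-map (suc o) T lower T-max)
  where
    lower : ∀ {e i} → suc o ≤ i → (e , i) ≤ₗ (v , o) → (e , i) <ₗ (v , o)
    lower _     (inj₁ e<v)         = inj₁ e<v
    lower o<i   (inj₂ (_ , i≤o))   = ⊥-elim (<⇒≱ o<i i≤o)
    strict : ∀ {e} → (e , suc o) ≤ₗ (v , o) → e < v
    strict (inj₁ e<v)       = e<v
    strict (inj₂ (_ , o<o)) = ⊥-elim (<-irrefl refl o<o)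
    shorten : ∀ T → HeadBelow ((a ∷ l) ∷ʳ v) T → AllCells (_≤ₗ (v , o)) (suc o) T → HeadBelow (a ∷ l) T
    shorten []         _           _              = just-nothing
    shorten (row₂ ∷ T) (just row⊒) (row₂-max , _) = just (∷ʳ-⊒⁻ (a ∷ l) v row⊒ (All.map strict row₂-max))
removeLargest o (suc r) R (row ∷ T) v l r+o≡R tab@(ne ∷ _ , inc ∷ _ , cols) row≡ (row-max , T-max)
  with removeLargest (suc o) r R T v l (trans (+-suc r o) r+o≡R) (IsTableau-tail tab) row≡ T-max
... | T′ , refl , (nes′ , incs′ , cols′) , ext′ , T′-below =
  row ∷ T′ , refl ,
  (ne ∷ nes′ , inc ∷ incs′ , HeadBelow-add⁻ row r v T′ (Linked.head′ cols) ∷′ cols′) ,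
  extendable r T′ ext′ cols , (All.map lower row-max , T′-below)
  where
    o<R : o < R
    o<R = subst (o <_) r+o≡R (s≤s (m≤n+m o r))
    lower : ∀ {e} → (e , o) ≤ₗ (v , R) → (e , o) <ₗ (v , R)
    lower (inj₁ e<v)       = inj₁ e<v
    lower (inj₂ (e≡v , _)) = inj₂ (e≡v , o<R)
    extendable : ∀ r T′ → Extendable T′ r → Linked _⊒_ (row ∷ add r v T′) → Extendable (row ∷ T′) (suc r)
    extendable (suc r) T′          ext _          = ext
    extendable zero    []          _   _          = ne
    extendable zero    (row₂ ∷ T′) _   (row⊒ ∷ _) = ≤-trans (≤-reflexive (sym (length-∷ʳ row₂ v))) (⊒-length row⊒)

<ₗ-suc : ∀ {w v a b} → (w , a + 0) <ₗ (v , b) → (w , suc a) <ₗ (v , suc b)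
<ₗ-suc (inj₁ w<v)         = inj₁ w<v
<ₗ-suc {a = a} (inj₂ (w≡v , a<b)) = inj₂ (w≡v , s≤s (subst (_< _) (+-identityʳ a) a<b))

tableau-surjective : ∀ s n T → IsSSYT n s T → ∃ λ ps → IsEncoding s ps × tableau ps ≡ T × length ps ≡ n
tableau-surjective s n       []        (cells≡n , _) = [] , ([] , [] , tt) , refl , cells≡n
tableau-surjective s zero    (row ∷ T) (cells≡0 , ne ∷ _ , _) =
  ⊥-elim (<⇒≱ ne (≤-trans (m≤m+n (length row) (cells T)) (≤-reflexive cells≡0)))
tableau-surjective s (suc n) T         (cells≡n , nes , inRange , incs , cols)
  with largestCell T (nes , incs , cols) (λ { refl → 0≢1+n cells≡n })
... | v , r , l , row≡ , T-max
  with removeLargest 0 r r T v l (+-identityʳ r) (nes , incs , cols) row≡ T-max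
... | T′ , refl , (nes′ , incs′ , cols′) , ext′ , T′-below
  with tableau-surjective s n T′
         (suc-injective (trans (sym (cells-add r T′ v ext′)) cells≡n) , nes′ ,
          AllCells⇒All 0 T′ (AllCells-add⁻ 0 r T′ v ext′ (All⇒AllCells 0 (add r v T′) inRange)) , incs′ , cols′)
... | ps′ , enc′@(inRange′ , dec′ , yam′) , refl , refl =
  (v , suc r) ∷ ps′ , (v∈ ∷ inRange′ , head-largest ps′ enc′ T′-below ∷′ dec′ , adm , yam′) , refl , refl
  where
    v∈ : InRange s v
    v∈ = All.lookup (AllCells-rowAt 0 (add r v (tableau ps′)) r (All⇒AllCells 0 _ inRange))
                    (subst (v ∈_) (sym row≡) (∈-++⁺ʳ l (here refl)))
    adm : Admissible (rows ps′) (suc r)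
    adm = Extendable⇒Admissible ps′ r (Invariant.rowLengths (encoding-invariant s ps′ enc′)) ext′
    head-largest : ∀ ps → IsEncoding s ps → AllCells (_<ₗ (v , r)) 0 (tableau ps) →
      Connected (flip _<ₗ_) (just (v , suc r)) (head ps)
    head-largest []                  _   _     = just-nothing
    head-largest ((w , suc r₂) ∷ ps) enc below =
      just (<ₗ-suc (All.lookup (AllCells-rowAt 0 _ r₂ below) (head∈tableau s w r₂ ps enc)))

-- Counting tableaux

-- suc (d + k) ≡ s says that k and d are complementary indices, k + d = s - 1.

complementary-∸ˡ : ∀ {s k} → k < s → suc (s ∸ k ∸ 1 + k) ≡ s
complementary-∸ˡ {s} {k} k<s = begin
  suc (s ∸ k ∸ 1 + k)   ≡⟨ cong (λ i → suc (i + k)) (trans (∸-+-assoc s k 1) (cong (s ∸_) (+-comm k 1))) ⟩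
  suc (s ∸ suc k + k)   ≡⟨ +-suc (s ∸ suc k) k ⟨
  s ∸ suc k + suc k     ≡⟨ m∸n+n≡m k<s ⟩
  s                     ∎
  where open ≡-Reasoning

complementary-∸ʳ : ∀ {s d} → d < s → suc (d + (s ∸ suc d)) ≡ s
complementary-∸ʳ = m+[n∸m]≡n

complementary⇒∸ : ∀ {s d k} → suc (d + k) ≡ s → s ∸ k ∸ 1 ≡ d
complementary⇒∸ {d = d} {k} refl = cong (_∸ 1) (m+n∸n≡m (suc d) k)

labellings⇒desʳ< : ∀ rs hi {ps} → 1 ≤ hi → ps ∈ labellings rs hi → desʳ rs < hi
labellings⇒desʳ< []       hi 1≤hi _   = 1≤hi
labellings⇒desʳ< (x ∷ rs) hi _    ps∈ with hi ≤? desʳ (x ∷ rs)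
... | yes hi≤d = ⊥-elim (Any.¬Any[] (subst (_ ∈_) (labellings-empty x rs hi hi≤d) ps∈))
... | no  hi≰d = ≰⇒> hi≰d

module SSYTCount (y : ℕ → ℕ → ℕ) (count-RY : ∀ n k → HasCount (IsRY n k) (y n k)) (n s : ℕ) where

  words : ℕ → List Word
  words k = HasCount.elems (count-RY n (s ∸ k ∸ 1))

  ∈-words : ∀ k {w} → w ∈ words k ⇔ IsRY n (s ∸ k ∸ 1) w
  ∈-words k {w} = HasCount.complete (count-RY n (s ∸ k ∸ 1)) w

  encodingsWith : ℕ → List (List Pair)
  encodingsWith k = concatMap (λ w → labellings (reverse w) s) (words k)

  encodings : List (List Pair)
  encodings = concatMap encodingsWith (upTo s)

  labelling-IsEncoding : ∀ k {w ps} → w ∈ words k → ps ∈ labellings (reverse w) s →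
    IsEncoding s ps × length ps ≡ n × rows ps ≡ reverse w
  labelling-IsEncoding k {w} {ps} w∈ ps∈
    with IsRY⇒Yamanouchi (Equivalence.to (∈-words k) w∈)
       | Labelling⇒LexDecreasing (reverse w) s ps (labellings-sound (reverse w) s ps∈)
  ... | length≡ , yam , _ | rows≡ , inRange , dec =
    (inRange , dec , subst Yamanouchi (sym rows≡) yam) ,
    trans (sym (length-map proj₂ ps)) (trans (cong length rows≡) length≡) ,
    rows≡

  ∈-encodings⁻ : ∀ {ps} → ps ∈ encodings → ∃ λ k → ∃ λ w → k < s × w ∈ words k × ps ∈ labellings (reverse w) s
  ∈-encodings⁻ ps∈ with ∈-concatMap⁻′ encodingsWith ps∈
  ... | k , k∈ , ps∈′ with ∈-concatMap⁻′ (λ w → labellings (reverse w) s) ps∈′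
  ...   | w , w∈ , ps∈″ = k , w , ∈-upTo⁻ k∈ , w∈ , ps∈″

  encodings-IsEncoding : ∀ {ps} → ps ∈ encodings → IsEncoding s ps
  encodings-IsEncoding ps∈ with ∈-encodings⁻ ps∈
  ... | k , _ , _ , w∈ , ps∈′ = proj₁ (labelling-IsEncoding k w∈ ps∈′)

  encodings-unique : Unique encodings
  encodings-unique = concatMap-unique encodingsWith (Unique.upTo⁺ s)
    (λ {k} _ → concatMap-unique (λ w → labellings (reverse w) s) (HasCount.unique (count-RY n (s ∸ k ∸ 1)))
       (λ {w} _ → labellings-unique (reverse w) s)
       (λ w∈ w′∈ ps∈ ps∈′ → same-word k k w∈ w′∈ ps∈ ps∈′))
    same-k
    where
      same-word : ∀ k k′ {w w′ ps} → w ∈ words k → w′ ∈ words k′ →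
        ps ∈ labellings (reverse w) s → ps ∈ labellings (reverse w′) s → w ≡ w′
      same-word k k′ w∈ w′∈ ps∈ ps∈′ =
        reverse-injective (trans (sym (proj₂ (proj₂ (labelling-IsEncoding k w∈ ps∈))))
                                 (proj₂ (proj₂ (labelling-IsEncoding k′ w′∈ ps∈′))))
      same-k : ∀ {k k′ ps} → k ∈ upTo s → k′ ∈ upTo s → ps ∈ encodingsWith k → ps ∈ encodingsWith k′ → k ≡ k′
      same-k {k} {k′} k∈ k′∈ ps∈ ps∈′
        with ∈-concatMap⁻′ (λ w → labellings (reverse w) s) ps∈
           | ∈-concatMap⁻′ (λ w → labellings (reverse w) s) ps∈′
      ... | w , w∈ , p∈ | w′ , w′∈ , p∈′ with same-word k k′ w∈ w′∈ p∈ p∈′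
      ...   | refl = +-cancelˡ-≡ (s ∸ k ∸ 1) k k′ (suc-injective (trans (complementary-∸ˡ (∈-upTo⁻ k∈))
                       (sym (subst (λ d → suc (d + k′) ≡ s) (sym des≡) (complementary-∸ˡ (∈-upTo⁻ k′∈))))))
        where des≡ : s ∸ k ∸ 1 ≡ s ∸ k′ ∸ 1
              des≡ = trans (sym (proj₂ (proj₂ (Equivalence.to (∈-words k) w∈))))
                           (proj₂ (proj₂ (Equivalence.to (∈-words k′) w′∈)))

  tableaux : List Tableau
  tableaux = map tableau encodings

  tableaux-unique : Unique tableaux
  tableaux-unique = map-unique tableau encodings-unique
    (λ ps∈ qs∈ → tableau-injective s _ _ (encodings-IsEncoding ps∈) (encodings-IsEncoding qs∈))

  ∈-tableaux : 1 ≤ s → ∀ {T} → T ∈ tableaux ⇔ IsSSYT n s T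
  ∈-tableaux 1≤s {T} = mk⇔ sound complete
    where
      sound : T ∈ tableaux → IsSSYT n s T
      sound T∈ with ∈-map⁻ tableau T∈
      ... | ps , ps∈ , refl with ∈-encodings⁻ ps∈
      ...   | k , _ , _ , w∈ , ps∈′ with labelling-IsEncoding k w∈ ps∈′
      ...     | enc , refl , _ = tableau-IsSSYT s ps enc

      complete : IsSSYT n s T → T ∈ tableaux
      complete ssyt with tableau-surjective s n T ssyt
      ... | ps , (inRange , dec , yam) , refl , refl =
        ∈-map⁺ tableau (∈-concatMap⁺′ encodingsWith (∈-upTo⁺ k<s)
                          (∈-concatMap⁺′ (λ w → labellings (reverse w) s) w∈ ps∈′))
        where
          rs = rows ps
          ps∈ : ps ∈ labellings rs s
          ps∈ = labellings-complete rs s (LexDecreasing⇒Labelling s ps inRange dec)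
          d<s : desʳ rs < s
          d<s = labellings⇒desʳ< rs s 1≤s ps∈
          k = s ∸ suc (desʳ rs)
          complementary : suc (desʳ rs + k) ≡ s
          complementary = complementary-∸ʳ d<s
          k<s : k < s
          k<s = subst (k <_) complementary (s≤s (m≤n+m k (desʳ rs)))
          w∈ : reverse rs ∈ words k
          w∈ = Equivalence.from (∈-words k)
                 (subst₂ (λ m d → IsRY m d (reverse rs)) (length-map proj₂ ps) (sym (complementary⇒∸ complementary))
                   (Yamanouchi⇒IsRY rs yam))
          ps∈′ : ps ∈ labellings (reverse (reverse rs)) s
          ps∈′ = subst (λ rs → ps ∈ labellings rs s) (sym (reverse-involutive rs)) ps∈

  length-encodingsWith : ∀ {k} → k < s → length (encodingsWith k) ≡ ((n + k) C k) * y n (s ∸ k ∸ 1)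
  length-encodingsWith {k} k<s = begin
    length (encodingsWith k)                                       ≡⟨ length-concatMap (λ w → labellings (reverse w) s) (words k) ⟩
    sum (map (λ w → length (labellings (reverse w) s)) (words k))   ≡⟨ sum-map-const _ (words k) ((n + k) C k) length-labellings-word ⟩
    ((n + k) C k) * length (words k)                                 ≡⟨ cong (λ m → ((n + k) C k) * m) (HasCount.size (count-RY n (s ∸ k ∸ 1))) ⟩
    ((n + k) C k) * y n (s ∸ k ∸ 1)                                  ∎
    where
      open ≡-Reasoning
      length-labellings-word : ∀ {w} → w ∈ words k → length (labellings (reverse w) s) ≡ (n + k) C k
      length-labellings-word {w} w∈ with IsRY⇒Yamanouchi (Equivalence.to (∈-words k) w∈)
      ... | length≡ , _ , des≡ = begin
        length (labellings (reverse w) s)                               ≡⟨ cong (λ hi → length (labellings (reverse w) hi)) s≡ ⟨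
        length (labellings (reverse w) (suc (desʳ (reverse w) + k)))    ≡⟨ length-labellings (reverse w) k ⟩
        (length (reverse w) + k) C k                                   ≡⟨ cong (λ m → (m + k) C k) length≡ ⟩
        (n + k) C k                                                    ∎
        where s≡ : suc (desʳ (reverse w) + k) ≡ s
              s≡ = trans (cong (λ d → suc (d + k)) des≡) (complementary-∸ˡ k<s)

  length-tableaux : length tableaux ≡ sum (map (λ k → ((n + k) C k) * y n (s ∸ k ∸ 1)) (upTo s))
  length-tableaux = begin
    length tableaux                                        ≡⟨ length-map tableau encodings ⟩
    length encodings                                       ≡⟨ length-concatMap encodingsWith (upTo s) ⟩
    sum (map (length ∘ encodingsWith) (upTo s))            ≡⟨ sum-map-cong-∈ _ _ (upTo s) (length-encodingsWith ∘ ∈-upTo⁻) ⟩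
    sum (map (λ k → ((n + k) C k) * y n (s ∸ k ∸ 1)) (upTo s)) ∎
    where open ≡-Reasoning

  count-SSYT : ∀ {c} → 1 ≤ s → HasCount (IsSSYT n s) c → c ≡ sum (map (λ k → ((n + k) C k) * y n (s ∸ k ∸ 1)) (upTo s))
  count-SSYT 1≤s count = trans (sym (HasCount-length count tableaux-unique (∈-tableaux 1≤s))) length-tableaux

open import Data.Integer using (ℤ; +_; -_; _^_) renaming (_*_ to _*ℤ_)
import Data.Integer.Properties as ℤ

count-inversion : ∀ n (a y : ℕ → ℕ) →
  (∀ s → 1 ≤ s → a s ≡ sum (map (λ k → ((n + k) C k) * y (s ∸ k ∸ 1)) (upTo s))) →
  ∀ k → + (y k) ≡ sumℤ (map (λ i → ((- (+ 1)) ^ (k ∸ i)) *ℤ (+ ((suc n) C (k ∸ i)) *ℤ + (a (suc i)))) (upTo (suc k)))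
count-inversion n a y a≡ k = begin
  y⁺ k                                                          ≡⟨ binomial-inversion (suc n) y⁺ a⁺ a⁺≗y⁺⋆[1-x]^-[1+n] k ⟩
  ([1-x]^ (suc n) ⋆ a⁺) k                                       ≡⟨ ∑-cong (suc k) (λ {i} _ → ℤ.*-assoc (sign i) (binom i) (a⁺ i)) ⟩
  ∑ (suc k) (λ i → sign i *ℤ (binom i *ℤ a⁺ i))                 ≡⟨ sumℤ-upTo (λ i → sign i *ℤ (binom i *ℤ a⁺ i)) (suc k) ⟨
  sumℤ (map (λ i → sign i *ℤ (binom i *ℤ a⁺ i)) (upTo (suc k))) ∎
  where
    open ≡-Reasoning
    y⁺ a⁺ : Series
    y⁺ j = + y j
    a⁺ i = + a (suc i)
    sign binom : ℕ → ℤ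
    sign i  = (- (+ 1)) ^ (k ∸ i)
    binom i = + (suc n C (k ∸ i))
    a⁺≗y⁺⋆[1-x]^-[1+n] : ∀ i → a⁺ i ≡ (y⁺ ⋆ [1-x]^- (suc n)) i
    a⁺≗y⁺⋆[1-x]^-[1+n] i = begin
      + a (suc i)                                ≡⟨ cong +_ (a≡ (suc i) (s≤s z≤n)) ⟩
      + sum (map term (upTo (suc i)))            ≡⟨ pos-sum term (upTo (suc i)) ⟩
      sumℤ (map (λ j → + term j) (upTo (suc i))) ≡⟨ sumℤ-upTo (λ j → + term j) (suc i) ⟩
      ∑ (suc i) (λ j → + term j)                 ≡⟨ ∑-cong (suc i) (λ {j} _ → term≡ j) ⟩
      (y⁺ ⋆ [1-x]^- (suc n)) i                   ∎
      where
        term : ℕ → ℕ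
        term j = ((n + j) C j) * y (suc i ∸ j ∸ 1)
        term≡ : ∀ j → + term j ≡ y⁺ (i ∸ j) *ℤ + ((n + j) C j)
        term≡ j = trans (ℤ.pos-* ((n + j) C j) (y (suc i ∸ j ∸ 1)))
                 (trans (ℤ.*-comm (+ ((n + j) C j)) (+ y (suc i ∸ j ∸ 1)))
                        (cong (λ m → + y m *ℤ + ((n + j) C j)) (trans (∸-+-assoc (suc i) j 1) (cong (suc i ∸_) (+-comm j 1)))))

theorem3 : (a y : ℕ → ℕ → ℕ)
    → (∀ n s → HasCount (IsSSYT n s) (a n s))
    → (∀ n k → HasCount (IsRY n k) (y n k))
    → (∀ n s → 1 ≤ s
    → a n s ≡ sum (map (λ k → ((n + k) C k) * y n (s ∸ k ∸ 1)) (upTo s)))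
    × (∀ n k → + (y n k) ≡ sumℤ (map (λ i → ((- (+ 1)) ^ (k ∸ i)) *ℤ (+ ((suc n) C (k ∸ i)) *ℤ + (a n (suc i)))) (upTo (suc k))))
theorem3 a y count-SSYT count-RY = a≡ , λ n → count-inversion n (a n) (y n) (a≡ n)
  where
    a≡ : ∀ n s → 1 ≤ s → a n s ≡ sum (map (λ k → ((n + k) C k) * y n (s ∸ k ∸ 1)) (upTo s))
    a≡ n s 1≤s = SSYTCount.count-SSYT y count-RY n s 1≤s (count-SSYT n s)
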